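{- Let $0<k<N$ be integers, let $j\in[N]$, and let $\mathcal{W}\subseteq \mathcal{P}_k([N])$ be an independent set in $J(N,k)$. For $S\in\mathcal{W}$ define \[ C_S^j = \begin{cases} A^N_{S\setminus\{j\}}, & j\in S,\\ B^N_{S\cup\{j\}}, & j\notin S.\end{cases} \] Then the sets $C_S^j$, $S\in\mathcal{W}$, are pairwise disjoint (i.e. $C_{S_1}^j\cap C_{S_2}^j=\emptyset$ for distinct $S_1,S_2\in\mathcal{W}$). In particular, if $|\mathcal{W}| = \alpha(J(N,k))$, if \[ \alpha(J(N,k)) = \frac{1}{\omega(J(N,k))}\binom{N}{k}, \] and if $|C_S^j| = \omega(J(N,k))$ for all $S\in\mathcal{W}$, then $\{C_S^j\}_{S\in\mathcal{W}}$ is a clique cover of $J(N,k)$ of minimum cardinality, and $\alpha(J(N,k)) = \theta(J(N,k))$.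
   Context: For integers $0<k<N$, let $[N]=\{1,\dots,N\}$ and let $\mathcal{P}_k([N])$ be the set of $k$-element subsets of $[N]$. The Johnson graph $J(N,k)$ has vertex set $\mathcal{P}_k([N])$, two vertices $S_1,S_2$ being adjacent iff $|S_1\cap S_2| = k-1$. For $S\in\mathcal{P}_{k-1}([N])$, $A_S^N=\{S\cup\{x\}\mid x\in[N]\setminus S\}$, and for $S\in\mathcal{P}_{k+1}([N])$, $B_S^N = \{S\setminus\{x\}\mid x\in S\}$; these are vertex sets of cliques of $J(N,k)$. $\alpha(G)$ is the independence number, $\omega(G)$ the clique number (for $J(N,k)$, $\omega = \max(N-k+1,k+1)$), and $\theta(G)$ the smallest cardinality of a clique cover of $G$ (a collection of cliques whose vertex sets cover all vertices). -}

module Defs where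

open import Data.Nat using (ℕ; _≤_; _∸_; suc)
open import Data.Fin using (Fin)
open import Data.Fin.Subset using (Subset; ∣_∣; _∩_; _∪_; _-_; ⁅_⁆)
  renaming (_∈_ to _∈ₛ_; _∉_ to _∉ₛ_)
open import Data.Fin.Subset.Properties using (_∈?_)
open import Data.List using (List; map; filter; length; allFin)
open import Data.List.Membership.Propositional using (_∈_)
open import Data.List.Relation.Unary.Unique.Propositional using (Unique)
open import Data.Product using (Σ; _×_; ∃)
open import Data.Empty using (⊥)
open import Relation.Nullary using (¬_; ¬?; yes; no)
open import Relation.Binary.PropositionalEquality using (_≡_; _≢_)

IsVertex : (N k : ℕ) → Subset N → Set
IsVertex N k S = ∣ S ∣ ≡ k

Adj : (N k : ℕ) → Subset N → Subset N → Set
Adj N k S₁ S₂ = ∣ S₁ ∩ S₂ ∣ ≡ k ∸ 1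

-- A finite set of vertices is a duplicate-free list of vertices.
IsVertexSet : (N k : ℕ) → List (Subset N) → Set
IsVertexSet N k X = Unique X × (∀ {S} → S ∈ X → IsVertex N k S)

IsIndependent : (N k : ℕ) → List (Subset N) → Set
IsIndependent N k W = IsVertexSet N k W ×
  (∀ {S₁ S₂} → S₁ ∈ W → S₂ ∈ W → S₁ ≢ S₂ → ¬ Adj N k S₁ S₂)

IsClique : (N k : ℕ) → List (Subset N) → Set
IsClique N k K = IsVertexSet N k K ×
  (∀ {S₁ S₂} → S₁ ∈ K → S₂ ∈ K → S₁ ≢ S₂ → Adj N k S₁ S₂)

IsCliqueCover : (N k : ℕ) → List (List (Subset N)) → Set
IsCliqueCover N k 𝒞 = (∀ {K} → K ∈ 𝒞 → IsClique N k K) ×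
  (∀ (T : Subset N) → IsVertex N k T → ∃ λ K → K ∈ 𝒞 × T ∈ K)

IsIndependenceNumber : (N k : ℕ) → ℕ → Set
IsIndependenceNumber N k a =
  (∃ λ W → IsIndependent N k W × length W ≡ a) ×
  (∀ W → IsIndependent N k W → length W ≤ a)

IsCliqueNumber : (N k : ℕ) → ℕ → Set
IsCliqueNumber N k w =
  (∃ λ K → IsClique N k K × length K ≡ w) ×
  (∀ K → IsClique N k K → length K ≤ w)

IsCliqueCoverNumber : (N k : ℕ) → ℕ → Set
IsCliqueCoverNumber N k t =
  (∃ λ 𝒞 → IsCliqueCover N k 𝒞 × length 𝒞 ≡ t) ×
  (∀ 𝒞 → IsCliqueCover N k 𝒞 → t ≤ length 𝒞)

A : (N : ℕ) → Subset N → List (Subset N)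
A N R = map (λ x → R ∪ ⁅ x ⁆) (filter (λ x → ¬? (x ∈? R)) (allFin N))

B : (N : ℕ) → Subset N → List (Subset N)
B N R = map (λ x → R - x) (filter (λ x → x ∈? R) (allFin N))

Cj : (N : ℕ) → Fin N → Subset N → List (Subset N)
Cj N j S with j ∈? S
... | yes _ = A N (S - j)
... | no  _ = B N (S ∪ ⁅ j ⁆)

-- If T lies in C^j_S, then T ⊇ S ∖ {j} when j ∈ S and T ⊆ S ∪ {j} when j ∉ S. So if T lies in
-- both C^j_{S₁} and C^j_{S₂}, then S₁ and S₂ either share a subset of size k − 1 or lie in a common
-- set of size k + 1; either way |S₁ ∩ S₂| ≥ k − 1, and distinct S₁, S₂ are adjacent. Hence the
-- cliques C^j_S of an independent set W are pairwise disjoint. When their sizes add up to C(N,k)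
-- they exhaust all k-subsets, so they form a clique cover; it is minimum because a clique contains
-- at most one vertex of W, which also gives α ≤ θ ≤ |W| ≤ α.
module Submission where

open import Defs
open import Data.Nat using (ℕ; _<_; _≤_; _*_)
open import Data.Nat.Combinatorics using (_C_)
open import Data.Fin using (Fin)
open import Data.Fin.Subset using (Subset)
open import Data.List using (List; map; length)
open import Data.List.Membership.Propositional using (_∈_)
open import Data.Product using (_×_)
open import Data.Empty using (⊥)
open import Relation.Binary.PropositionalEquality using (_≡_; _≢_)

open import Data.Nat using (zero; suc; _+_; _∸_; z≤n; s≤s)
open import Data.Nat.Properties
  using (≤-refl; ≤-trans; ≤-reflexive; ≤-antisym; ≤∧≢⇒<; <-irrefl; n≤1+n; +-suc; +-cancelʳ-≤;
         +-mono-≤; suc-injective; module ≤-Reasoning)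
open import Data.Nat.Combinatorics using (nCk+nC[k+1]≡[n+1]C[k+1])
open import Data.Fin using (zero; suc) renaming (_≟_ to _≟ᶠ_)
open import Data.Fin.Subset using (∣_∣; _∩_; _∪_; _─_; _-_; ⁅_⁆; _⊆_; inside; outside)
  renaming (_∈_ to _∈ₛ_; _∉_ to _∉ₛ_)
open import Data.Fin.Subset.Properties
  using (_∈?_; p⊆q⇒∣p∣≤∣q∣; drop-∷-⊆; ∪-identityʳ; p─⊥≡p; p─q─q≡p─q; p─q⊆p; p∩q⊆p; p∩q⊆q;
         ∣p∩q∣≤∣p∣; ∩-comm; x∈p∩q⁺; x∈p∪q⁺; x∈p∪q⁻; x∈⁅x⁆; x∈⁅y⁆⇒x≡y; x∉⁅y⁆⇒x≢y;
         x∈p∧x≢y⇒x∈p-y; ⊆-refl; ⊆-trans; p⊆p∪q)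
open import Data.Vec using ([]; _∷_; here; there)
import Data.Vec.Properties as Vec
import Data.Bool as Bool
open import Data.List using ([]; _∷_; _++_; concat; filter; allFin)
open import Data.List.Properties using (length-map; length-++; length-removeAt′)
open import Data.List.Membership.Propositional using () renaming (_─_ to _⊝_)
open import Data.List.Membership.Propositional.Properties
  using (∈-map⁺; ∈-map⁻; ∈-++⁺ˡ; ∈-++⁺ʳ; ∈-filter⁻; ∈-concat⁻′)
open import Data.List.Relation.Unary.Any using (here; there; any?)
import Data.List.Relation.Unary.All as All
import Data.List.Relation.Unary.All.Properties as All
open import Data.List.Relation.Unary.AllPairs using (AllPairs; []; _∷_)
import Data.List.Relation.Unary.AllPairs.Properties as AllPairs
import Data.List.Relation.Unary.Unique.Propositional.Properties as Unique
open import Data.List.Relation.Unary.Unique.Propositional using (Unique)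
open import Data.List.Relation.Binary.Disjoint.Propositional using (Disjoint)
open import Data.Sum using (_⊎_; inj₁; inj₂)
import Data.Sum as Sum
open import Data.Product using (_,_; proj₁; proj₂; ∃)
open import Data.Empty using (⊥-elim)
open import Relation.Nullary using (¬?; yes; no)
open import Relation.Binary.PropositionalEquality
  using (refl; sym; trans; cong; cong₂; subst; module ≡-Reasoning)
open import Function using (_∘_)

private variable
  n k : ℕ
  p q U V R T S₁ S₂ : Subset n
  x y : Fin n

x∈p─q⇒x∉q : x ∈ₛ p ─ q → x ∉ₛ q
x∈p─q⇒x∉q {p = _ ∷ _} {q = outside ∷ q} (there x∈) (there x∈q) = x∈p─q⇒x∉q x∈ x∈q
x∈p─q⇒x∉q {p = _ ∷ _} {q = inside ∷ q} (there x∈) (there x∈q) = x∈p─q⇒x∉q x∈ x∈q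

x∈p-y⇒x≢y : x ∈ₛ p - y → x ≢ y
x∈p-y⇒x≢y = x∉⁅y⁆⇒x≢y ∘ x∈p─q⇒x∉q

p-x⊆q⇒p⊆q∪⁅x⁆ : p - x ⊆ q → p ⊆ q ∪ ⁅ x ⁆
p-x⊆q⇒p⊆q∪⁅x⁆ {x = x} p-x⊆q {y} y∈p with y ≟ᶠ x
... | yes refl = x∈p∪q⁺ (inj₂ (x∈⁅x⁆ y))
... | no  y≢x  = x∈p∪q⁺ (inj₁ (p-x⊆q (x∈p∧x≢y⇒x∈p-y y∈p y≢x)))

p⊆q∪⁅x⁆⇒p-x⊆q : p ⊆ q ∪ ⁅ x ⁆ → p - x ⊆ q
p⊆q∪⁅x⁆⇒p-x⊆q {p = p} {q = q} {x = x} p⊆q∪x y∈p-x with x∈p∪q⁻ q ⁅ x ⁆ (p⊆q∪x (p─q⊆p p ⁅ x ⁆ y∈p-x))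
... | inj₁ y∈q = y∈q
... | inj₂ y∈x = ⊥-elim (x∈p-y⇒x≢y y∈p-x (x∈⁅y⁆⇒x≡y x y∈x))

∣p∪⁅x⁆∣≤1+∣p∣ : ∀ (p : Subset n) x → ∣ p ∪ ⁅ x ⁆ ∣ ≤ suc ∣ p ∣
∣p∪⁅x⁆∣≤1+∣p∣ (inside  ∷ p) zero    = s≤s (≤-trans (≤-reflexive (cong ∣_∣ (∪-identityʳ p))) (n≤1+n _))
∣p∪⁅x⁆∣≤1+∣p∣ (outside ∷ p) zero    = ≤-reflexive (cong (suc ∘ ∣_∣) (∪-identityʳ p))
∣p∪⁅x⁆∣≤1+∣p∣ (inside  ∷ p) (suc x) = s≤s (∣p∪⁅x⁆∣≤1+∣p∣ p x)
∣p∪⁅x⁆∣≤1+∣p∣ (outside ∷ p) (suc x) = ∣p∪⁅x⁆∣≤1+∣p∣ p x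

x∉p⇒∣p∪⁅x⁆∣≡1+∣p∣ : ∀ (p : Subset n) x → x ∉ₛ p → ∣ p ∪ ⁅ x ⁆ ∣ ≡ suc ∣ p ∣
x∉p⇒∣p∪⁅x⁆∣≡1+∣p∣ (inside  ∷ p) zero    x∉p = ⊥-elim (x∉p here)
x∉p⇒∣p∪⁅x⁆∣≡1+∣p∣ (outside ∷ p) zero    x∉p = cong (suc ∘ ∣_∣) (∪-identityʳ p)
x∉p⇒∣p∪⁅x⁆∣≡1+∣p∣ (inside  ∷ p) (suc x) x∉p = cong suc (x∉p⇒∣p∪⁅x⁆∣≡1+∣p∣ p x (x∉p ∘ there))
x∉p⇒∣p∪⁅x⁆∣≡1+∣p∣ (outside ∷ p) (suc x) x∉p = x∉p⇒∣p∪⁅x⁆∣≡1+∣p∣ p x (x∉p ∘ there)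

x∈p⇒1+∣p-x∣≡∣p∣ : ∀ (p : Subset n) x → x ∈ₛ p → suc ∣ p - x ∣ ≡ ∣ p ∣
x∈p⇒1+∣p-x∣≡∣p∣ (inside  ∷ p) zero    here        = cong (suc ∘ ∣_∣) (p─⊥≡p p)
x∈p⇒1+∣p-x∣≡∣p∣ (inside  ∷ p) (suc x) (there x∈p) = cong suc (x∈p⇒1+∣p-x∣≡∣p∣ p x x∈p)
x∈p⇒1+∣p-x∣≡∣p∣ (outside ∷ p) (suc x) (there x∈p) = x∈p⇒1+∣p-x∣≡∣p∣ p x x∈p

∣p∣≤1+∣p-x∣ : ∀ (p : Subset n) x → ∣ p ∣ ≤ suc ∣ p - x ∣
∣p∣≤1+∣p-x∣ p x = ≤-trans (p⊆q⇒∣p∣≤∣q∣ (p-x⊆q⇒p⊆q∪⁅x⁆ {p = p} {x = x} ⊆-refl)) (∣p∪⁅x⁆∣≤1+∣p∣ (p - x) x)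

∣p∩q∣+∣p∪q∣≡∣p∣+∣q∣ : ∀ (p q : Subset n) → ∣ p ∩ q ∣ + ∣ p ∪ q ∣ ≡ ∣ p ∣ + ∣ q ∣
∣p∩q∣+∣p∪q∣≡∣p∣+∣q∣ []            []            = refl
∣p∩q∣+∣p∪q∣≡∣p∣+∣q∣ (inside  ∷ p) (inside  ∷ q) =
  cong suc (trans (+-suc _ _) (trans (cong suc (∣p∩q∣+∣p∪q∣≡∣p∣+∣q∣ p q)) (sym (+-suc _ _))))
∣p∩q∣+∣p∪q∣≡∣p∣+∣q∣ (inside  ∷ p) (outside ∷ q) = trans (+-suc _ _) (cong suc (∣p∩q∣+∣p∪q∣≡∣p∣+∣q∣ p q))
∣p∩q∣+∣p∪q∣≡∣p∣+∣q∣ (outside ∷ p) (inside  ∷ q) =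
  trans (+-suc _ _) (trans (cong suc (∣p∩q∣+∣p∪q∣≡∣p∣+∣q∣ p q)) (sym (+-suc _ _)))
∣p∩q∣+∣p∪q∣≡∣p∣+∣q∣ (outside ∷ p) (outside ∷ q) = ∣p∩q∣+∣p∪q∣≡∣p∣+∣q∣ p q

p⊆q∧∣p∣≡∣q∣⇒p≡q : p ⊆ q → ∣ p ∣ ≡ ∣ q ∣ → p ≡ q
p⊆q∧∣p∣≡∣q∣⇒p≡q {p = []}          {[]}          _   _ = refl
p⊆q∧∣p∣≡∣q∣⇒p≡q {p = inside  ∷ p} {inside  ∷ q} p⊆q e =
  cong (inside ∷_) (p⊆q∧∣p∣≡∣q∣⇒p≡q (drop-∷-⊆ p⊆q) (suc-injective e))
p⊆q∧∣p∣≡∣q∣⇒p≡q {p = outside ∷ p} {outside ∷ q} p⊆q e =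
  cong (outside ∷_) (p⊆q∧∣p∣≡∣q∣⇒p≡q (drop-∷-⊆ p⊆q) e)
p⊆q∧∣p∣≡∣q∣⇒p≡q {p = inside  ∷ p} {outside ∷ q} p⊆q e with p⊆q here
... | ()
p⊆q∧∣p∣≡∣q∣⇒p≡q {p = outside ∷ p} {inside  ∷ q} p⊆q e =
  ⊥-elim (<-irrefl e (s≤s (p⊆q⇒∣p∣≤∣q∣ (drop-∷-⊆ p⊆q))))

U⊆p∧U⊆q⇒∣U∣≤∣p∩q∣ : U ⊆ p → U ⊆ q → ∣ U ∣ ≤ ∣ p ∩ q ∣
U⊆p∧U⊆q⇒∣U∣≤∣p∩q∣ U⊆p U⊆q = p⊆q⇒∣p∣≤∣q∣ (λ x∈U → x∈p∩q⁺ (U⊆p x∈U , U⊆q x∈U))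

p⊆V∧q⊆V⇒∣p∣+∣q∣≤∣p∩q∣+∣V∣ : p ⊆ V → q ⊆ V → ∣ p ∣ + ∣ q ∣ ≤ ∣ p ∩ q ∣ + ∣ V ∣
p⊆V∧q⊆V⇒∣p∣+∣q∣≤∣p∩q∣+∣V∣ {p = p} {V = V} {q = q} p⊆V q⊆V = begin
  ∣ p ∣ + ∣ q ∣         ≡⟨ sym (∣p∩q∣+∣p∪q∣≡∣p∣+∣q∣ p q) ⟩
  ∣ p ∩ q ∣ + ∣ p ∪ q ∣ ≤⟨ +-mono-≤ ≤-refl (p⊆q⇒∣p∣≤∣q∣ p∪q⊆V) ⟩
  ∣ p ∩ q ∣ + ∣ V ∣     ∎
  where
  open ≤-Reasoning
  p∪q⊆V : p ∪ q ⊆ V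
  p∪q⊆V x∈p∪q with x∈p∪q⁻ p q x∈p∪q
  ... | inj₁ x∈p = p⊆V x∈p
  ... | inj₂ x∈q = q⊆V x∈q

AllPairs-map∈ : ∀ {X : Set} {P Q : X → X → Set} {xs : List X} →
  (∀ {a b} → a ∈ xs → b ∈ xs → P a b → Q a b) → AllPairs P xs → AllPairs Q xs
AllPairs-map∈ f []         = []
AllPairs-map∈ f (Ps ∷ ps) =
  All.tabulate (λ b∈ → f (here refl) (there b∈) (All.lookup Ps b∈))
  ∷ AllPairs-map∈ (λ a∈ b∈ → f (there a∈) (there b∈)) ps

Unique-map⁺-on : ∀ {X Y : Set} {f : X → Y} {xs : List X} →
  (∀ {a b} → a ∈ xs → b ∈ xs → f a ≡ f b → a ≡ b) → Unique xs → Unique (map f xs)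
Unique-map⁺-on inj = AllPairs.map⁺ ∘ AllPairs-map∈ (λ a∈ b∈ a≢b → a≢b ∘ inj a∈ b∈)

-- Adjacency in the Johnson graph

Adj-sym : Adj n k S₁ S₂ → Adj n k S₂ S₁
Adj-sym {S₁ = S₁} {S₂ = S₂} = subst (λ X → ∣ X ∣ ≡ _) (∩-comm S₁ S₂)

distinct⇒∣∩∣<k : IsVertex n k S₁ → IsVertex n k S₂ → S₁ ≢ S₂ → ∣ S₁ ∩ S₂ ∣ < k
distinct⇒∣∩∣<k {S₁ = S₁} {S₂ = S₂} refl v₂ S₁≢S₂ = ≤∧≢⇒< (∣p∩q∣≤∣p∣ S₁ S₂) ∣∩∣≢∣S₁∣
  where
  ∣∩∣≢∣S₁∣ : ∣ S₁ ∩ S₂ ∣ ≢ ∣ S₁ ∣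
  ∣∩∣≢∣S₁∣ e = S₁≢S₂ (trans (sym (p⊆q∧∣p∣≡∣q∣⇒p≡q (p∩q⊆p S₁ S₂) e))
                             (p⊆q∧∣p∣≡∣q∣⇒p≡q (p∩q⊆q S₁ S₂) (trans e (sym v₂))))

k≤1+∣∩∣⇒Adj : IsVertex n k S₁ → IsVertex n k S₂ → S₁ ≢ S₂ → k ≤ suc ∣ S₁ ∩ S₂ ∣ → Adj n k S₁ S₂
k≤1+∣∩∣⇒Adj v₁ v₂ S₁≢S₂ k≤ = cong (_∸ 1) (≤-antisym (distinct⇒∣∩∣<k v₁ v₂ S₁≢S₂) k≤)

commonSubset⇒Adj : IsVertex n k S₁ → IsVertex n k S₂ → S₁ ≢ S₂ →
  U ⊆ S₁ → U ⊆ S₂ → k ≤ suc ∣ U ∣ → Adj n k S₁ S₂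
commonSubset⇒Adj v₁ v₂ S₁≢S₂ U⊆S₁ U⊆S₂ k≤ =
  k≤1+∣∩∣⇒Adj v₁ v₂ S₁≢S₂ (≤-trans k≤ (s≤s (U⊆p∧U⊆q⇒∣U∣≤∣p∩q∣ U⊆S₁ U⊆S₂)))

commonSuperset⇒Adj : IsVertex n k S₁ → IsVertex n k S₂ → S₁ ≢ S₂ →
  S₁ ⊆ V → S₂ ⊆ V → ∣ V ∣ ≤ suc k → Adj n k S₁ S₂
commonSuperset⇒Adj {k = k} {S₁ = S₁} {S₂ = S₂} {V = V} v₁ v₂ S₁≢S₂ S₁⊆V S₂⊆V ∣V∣≤ =
  k≤1+∣∩∣⇒Adj v₁ v₂ S₁≢S₂ (+-cancelʳ-≤ k k (suc ∣ S₁ ∩ S₂ ∣) (begin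
    k + k                   ≡⟨ sym (cong₂ _+_ v₁ v₂) ⟩
    ∣ S₁ ∣ + ∣ S₂ ∣         ≤⟨ p⊆V∧q⊆V⇒∣p∣+∣q∣≤∣p∩q∣+∣V∣ S₁⊆V S₂⊆V ⟩
    ∣ S₁ ∩ S₂ ∣ + ∣ V ∣     ≤⟨ +-mono-≤ (≤-refl {∣ S₁ ∩ S₂ ∣}) ∣V∣≤ ⟩
    ∣ S₁ ∩ S₂ ∣ + suc k     ≡⟨ +-suc ∣ S₁ ∩ S₂ ∣ k ⟩
    suc ∣ S₁ ∩ S₂ ∣ + k     ∎))
  where open ≤-Reasoning

∈-A⁻ : T ∈ A n R → ∃ λ x → x ∉ₛ R × T ≡ R ∪ ⁅ x ⁆
∈-A⁻ {n = n} {R = R} T∈A with ∈-map⁻ (λ x → R ∪ ⁅ x ⁆) T∈A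
... | x , x∈ , T≡ = x , proj₂ (∈-filter⁻ (λ x → ¬? (x ∈? R)) {xs = allFin n} x∈) , T≡

∈-B⁻ : T ∈ B n R → ∃ λ x → x ∈ₛ R × T ≡ R - x
∈-B⁻ {n = n} {R = R} T∈B with ∈-map⁻ (R -_) T∈B
... | x , x∈ , T≡ = x , proj₂ (∈-filter⁻ (_∈? R) {xs = allFin n} x∈) , T≡

∈-A⇒⊆ : T ∈ A n R → R ⊆ T
∈-A⇒⊆ T∈A with ∈-A⁻ T∈A
... | x , _ , refl = p⊆p∪q ⁅ x ⁆

∈-A⇒∣T∣≡1+∣R∣ : T ∈ A n R → ∣ T ∣ ≡ suc ∣ R ∣
∈-A⇒∣T∣≡1+∣R∣ {R = R} T∈A with ∈-A⁻ T∈A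
... | x , x∉R , refl = x∉p⇒∣p∪⁅x⁆∣≡1+∣p∣ R x x∉R

∈-B⇒⊆ : T ∈ B n R → T ⊆ R
∈-B⇒⊆ {R = R} T∈B with ∈-B⁻ T∈B
... | x , _ , refl = p─q⊆p R ⁅ x ⁆

∈-B⇒1+∣T∣≡∣R∣ : T ∈ B n R → suc ∣ T ∣ ≡ ∣ R ∣
∈-B⇒1+∣T∣≡∣R∣ {R = R} T∈B with ∈-B⁻ T∈B
... | x , x∈R , refl = x∈p⇒1+∣p-x∣≡∣p∣ R x x∈R

A-unique : ∀ n (R : Subset n) → Unique (A n R)
A-unique n R = Unique-map⁺-on ∪⁅⁆-injective (Unique.filter⁺ (λ x → ¬? (x ∈? R)) (Unique.allFin⁺ n))
  where
  ∪⁅⁆-injective : ∀ {a b} → a ∈ filter (λ x → ¬? (x ∈? R)) (allFin n) → b ∈ _ →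
    R ∪ ⁅ a ⁆ ≡ R ∪ ⁅ b ⁆ → a ≡ b
  ∪⁅⁆-injective {a} {b} a∈ _ e with x∈p∪q⁻ R ⁅ b ⁆ (subst (a ∈ₛ_) e (x∈p∪q⁺ (inj₂ (x∈⁅x⁆ a))))
  ... | inj₁ a∈R = ⊥-elim (proj₂ (∈-filter⁻ (λ x → ¬? (x ∈? R)) {xs = allFin n} a∈) a∈R)
  ... | inj₂ a∈b = x∈⁅y⁆⇒x≡y b a∈b

B-unique : ∀ n (R : Subset n) → Unique (B n R)
B-unique n R = Unique-map⁺-on ─⁅⁆-injective (Unique.filter⁺ (_∈? R) (Unique.allFin⁺ n))
  where
  ─⁅⁆-injective : ∀ {a b} → a ∈ filter (_∈? R) (allFin n) → b ∈ _ → R - a ≡ R - b → a ≡ b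
  ─⁅⁆-injective {a} {b} a∈ _ e with a ≟ᶠ b
  ... | yes a≡b = a≡b
  ... | no  a≢b = ⊥-elim (x∈p-y⇒x≢y (subst (a ∈ₛ_) (sym e)
                    (x∈p∧x≢y⇒x∈p-y (proj₂ (∈-filter⁻ (_∈? R) {xs = allFin n} a∈)) a≢b)) refl)

A-isClique : ∀ n k (R : Subset n) → suc ∣ R ∣ ≡ k → IsClique n k (A n R)
A-isClique n k R ∣R∣≡ = (A-unique n R , vertex) , adjacent
  where
  vertex : ∀ {T} → T ∈ A n R → IsVertex n k T
  vertex T∈A = trans (∈-A⇒∣T∣≡1+∣R∣ T∈A) ∣R∣≡
  adjacent : ∀ {T₁ T₂} → T₁ ∈ A n R → T₂ ∈ A n R → T₁ ≢ T₂ → Adj n k T₁ T₂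
  adjacent T₁∈ T₂∈ T₁≢T₂ = commonSubset⇒Adj (vertex T₁∈) (vertex T₂∈) T₁≢T₂
    (∈-A⇒⊆ T₁∈) (∈-A⇒⊆ T₂∈) (≤-reflexive (sym ∣R∣≡))

B-isClique : ∀ n k (R : Subset n) → ∣ R ∣ ≡ suc k → IsClique n k (B n R)
B-isClique n k R ∣R∣≡ = (B-unique n R , vertex) , adjacent
  where
  vertex : ∀ {T} → T ∈ B n R → IsVertex n k T
  vertex T∈B = suc-injective (trans (∈-B⇒1+∣T∣≡∣R∣ T∈B) ∣R∣≡)
  adjacent : ∀ {T₁ T₂} → T₁ ∈ B n R → T₂ ∈ B n R → T₁ ≢ T₂ → Adj n k T₁ T₂
  adjacent T₁∈ T₂∈ T₁≢T₂ = commonSuperset⇒Adj (vertex T₁∈) (vertex T₂∈) T₁≢T₂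
    (∈-B⇒⊆ T₁∈) (∈-B⇒⊆ T₂∈) (≤-reflexive ∣R∣≡)

Cj-isClique : ∀ n k (j : Fin n) {S} → IsVertex n k S → IsClique n k (Cj n j S)
Cj-isClique n k j {S} ∣S∣≡k with j ∈? S
... | yes j∈S = A-isClique n k (S - j) (trans (x∈p⇒1+∣p-x∣≡∣p∣ S j j∈S) ∣S∣≡k)
... | no  j∉S = B-isClique n k (S ∪ ⁅ j ⁆) (trans (x∉p⇒∣p∪⁅x⁆∣≡1+∣p∣ S j j∉S) (cong suc ∣S∣≡k))

-- Disjointness of the cliques C^j_S

module _ {n k : ℕ} (j : Fin n) {S₁ S₂ T : Subset n}
         (v₁ : IsVertex n k S₁) (v₂ : IsVertex n k S₂) (S₁≢S₂ : S₁ ≢ S₂) where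

  A-meets-A⇒Adj : j ∈ₛ S₁ → T ∈ A n (S₁ - j) → T ∈ A n (S₂ - j) → Adj n k S₁ S₂
  A-meets-A⇒Adj j∈S₁ T∈A₁ T∈A₂ =
    commonSuperset⇒Adj v₁ v₂ S₁≢S₂ (p-x⊆q⇒p⊆q∪⁅x⁆ (∈-A⇒⊆ T∈A₁)) (p-x⊆q⇒p⊆q∪⁅x⁆ (∈-A⇒⊆ T∈A₂))
      (≤-trans (∣p∪⁅x⁆∣≤1+∣p∣ T j) (s≤s (≤-reflexive ∣T∣≡k)))
    where
    ∣T∣≡k : ∣ T ∣ ≡ k
    ∣T∣≡k = trans (∈-A⇒∣T∣≡1+∣R∣ T∈A₁) (trans (x∈p⇒1+∣p-x∣≡∣p∣ S₁ j j∈S₁) v₁)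

  A-meets-B⇒Adj : j ∈ₛ S₁ → T ∈ A n (S₁ - j) → T ∈ B n (S₂ ∪ ⁅ j ⁆) → Adj n k S₁ S₂
  A-meets-B⇒Adj j∈S₁ T∈A T∈B =
    commonSubset⇒Adj v₁ v₂ S₁≢S₂ (p─q⊆p S₁ ⁅ j ⁆) S₁-j⊆S₂
      (≤-reflexive (trans (sym v₁) (sym (x∈p⇒1+∣p-x∣≡∣p∣ S₁ j j∈S₁))))
    where
    S₁-j⊆S₂ : S₁ - j ⊆ S₂
    S₁-j⊆S₂ = subst (_⊆ S₂) (p─q─q≡p─q S₁ ⁅ j ⁆)
                (p⊆q∪⁅x⁆⇒p-x⊆q (⊆-trans (∈-A⇒⊆ T∈A) (∈-B⇒⊆ T∈B)))

  B-meets-B⇒Adj : j ∉ₛ S₁ → T ∈ B n (S₁ ∪ ⁅ j ⁆) → T ∈ B n (S₂ ∪ ⁅ j ⁆) → Adj n k S₁ S₂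
  B-meets-B⇒Adj j∉S₁ T∈B₁ T∈B₂ =
    commonSubset⇒Adj v₁ v₂ S₁≢S₂ (p⊆q∪⁅x⁆⇒p-x⊆q (∈-B⇒⊆ T∈B₁)) (p⊆q∪⁅x⁆⇒p-x⊆q (∈-B⇒⊆ T∈B₂))
      (subst (_≤ suc ∣ T - j ∣) ∣T∣≡k (∣p∣≤1+∣p-x∣ T j))
    where
    ∣T∣≡k : ∣ T ∣ ≡ k
    ∣T∣≡k = suc-injective (trans (∈-B⇒1+∣T∣≡∣R∣ T∈B₁)
                                 (trans (x∉p⇒∣p∪⁅x⁆∣≡1+∣p∣ S₁ j j∉S₁) (cong suc v₁)))

Cj-meet⇒Adj : ∀ n k (j : Fin n) {S₁ S₂ T} → IsVertex n k S₁ → IsVertex n k S₂ → S₁ ≢ S₂ →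
  T ∈ Cj n j S₁ → T ∈ Cj n j S₂ → Adj n k S₁ S₂
Cj-meet⇒Adj n k j {S₁} {S₂} v₁ v₂ S₁≢S₂ T∈C₁ T∈C₂ with j ∈? S₁ | j ∈? S₂
... | yes j∈S₁ | yes _    = A-meets-A⇒Adj j v₁ v₂ S₁≢S₂ j∈S₁ T∈C₁ T∈C₂
... | yes j∈S₁ | no  _    = A-meets-B⇒Adj j v₁ v₂ S₁≢S₂ j∈S₁ T∈C₁ T∈C₂
... | no  _    | yes j∈S₂ =
  Adj-sym {k = k} {S₁ = S₂} {S₂ = S₁} (A-meets-B⇒Adj j v₂ v₁ (S₁≢S₂ ∘ sym) j∈S₂ T∈C₂ T∈C₁)
... | no  j∉S₁ | no  _    = B-meets-B⇒Adj j v₁ v₂ S₁≢S₂ j∉S₁ T∈C₁ T∈C₂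

-- Counting

∈-⊝ : ∀ {X : Set} {y z : X} {ys} (y∈ys : y ∈ ys) → z ∈ ys → z ≡ y ⊎ z ∈ ys ⊝ y∈ys
∈-⊝ (here refl) (here refl) = inj₁ refl
∈-⊝ (here refl) (there z∈)  = inj₂ z∈
∈-⊝ (there y∈)  (here refl) = inj₂ (here refl)
∈-⊝ (there y∈)  (there z∈)  = Sum.map₂ there (∈-⊝ y∈ z∈)

injectiveRelation⇒length≤ : ∀ {X Y : Set} (R : X → Y → Set) {xs : List X} {ys : List Y} →
  Unique xs →
  (∀ {x} → x ∈ xs → ∃ λ y → y ∈ ys × R x y) →
  (∀ {x₁ x₂ y} → x₁ ∈ xs → x₂ ∈ xs → x₁ ≢ x₂ → R x₁ y → R x₂ y → ⊥) →
  length xs ≤ length ys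
injectiveRelation⇒length≤ R {[]}     _            _     _   = z≤n
injectiveRelation⇒length≤ R {x ∷ xs} {ys} (x∉xs ∷ xs!) total inj with total (here refl)
... | y , y∈ys , Rxy = begin
  suc (length xs)           ≤⟨ s≤s (injectiveRelation⇒length≤ R xs! total′ inj′) ⟩
  suc (length (ys ⊝ y∈ys))  ≡⟨ sym (length-removeAt′ ys _) ⟩
  length ys                 ∎
  where
  open ≤-Reasoning
  inj′ : ∀ {x₁ x₂ y} → x₁ ∈ xs → x₂ ∈ xs → x₁ ≢ x₂ → R x₁ y → R x₂ y → ⊥
  inj′ x₁∈ x₂∈ = inj (there x₁∈) (there x₂∈)
  total′ : ∀ {x′} → x′ ∈ xs → ∃ λ y′ → y′ ∈ ys ⊝ y∈ys × R x′ y′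
  total′ x′∈xs with total (there x′∈xs)
  ... | y′ , y′∈ys , Rx′y′ with ∈-⊝ y∈ys y′∈ys
  ... | inj₁ refl =
    ⊥-elim (inj (there x′∈xs) (here refl) (λ x′≡x → All.lookup x∉xs x′∈xs (sym x′≡x)) Rx′y′ Rxy)
  ... | inj₂ y′∈ = y′ , y′∈ , Rx′y′

subsetsOfSize : ∀ n → ℕ → List (Subset n)
subsetsOfSize zero    zero    = [] ∷ []
subsetsOfSize zero    (suc k) = []
subsetsOfSize (suc n) zero    = map (outside ∷_) (subsetsOfSize n zero)
subsetsOfSize (suc n) (suc k) =
  map (inside ∷_) (subsetsOfSize n k) ++ map (outside ∷_) (subsetsOfSize n (suc k))

length-subsetsOfSize : ∀ n k → length (subsetsOfSize n k) ≡ n C k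
length-subsetsOfSize zero    zero    = refl
length-subsetsOfSize zero    (suc k) = refl
length-subsetsOfSize (suc n) zero    =
  trans (length-map _ (subsetsOfSize n zero)) (length-subsetsOfSize n zero)
length-subsetsOfSize (suc n) (suc k) = begin
  length (map (inside ∷_) (subsetsOfSize n k) ++ map (outside ∷_) (subsetsOfSize n (suc k)))
    ≡⟨ length-++ (map (inside ∷_) (subsetsOfSize n k)) ⟩
  length (map (inside ∷_) (subsetsOfSize n k))
    + length (map (outside ∷_) (subsetsOfSize n (suc k)))
    ≡⟨ cong₂ _+_ (length-map _ (subsetsOfSize n k)) (length-map _ (subsetsOfSize n (suc k))) ⟩
  length (subsetsOfSize n k) + length (subsetsOfSize n (suc k))
    ≡⟨ cong₂ _+_ (length-subsetsOfSize n k) (length-subsetsOfSize n (suc k)) ⟩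
  n C k + n C suc k
    ≡⟨ nCk+nC[k+1]≡[n+1]C[k+1] n k ⟩
  suc n C suc k ∎
  where open ≡-Reasoning

∈-subsetsOfSize : ∀ n k (p : Subset n) → ∣ p ∣ ≡ k → p ∈ subsetsOfSize n k
∈-subsetsOfSize zero    zero    []            _ = here refl
∈-subsetsOfSize (suc n) zero    (outside ∷ p) e = ∈-map⁺ (outside ∷_) (∈-subsetsOfSize n zero p e)
∈-subsetsOfSize (suc n) (suc k) (inside  ∷ p) e =
  ∈-++⁺ˡ (∈-map⁺ (inside ∷_) (∈-subsetsOfSize n k p (suc-injective e)))
∈-subsetsOfSize (suc n) (suc k) (outside ∷ p) e =
  ∈-++⁺ʳ (map (inside ∷_) (subsetsOfSize n k)) (∈-map⁺ (outside ∷_) (∈-subsetsOfSize n (suc k) p e))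

vertexSet⇒length≤nCk : ∀ n k (L : List (Subset n)) → IsVertexSet n k L → length L ≤ n C k
vertexSet⇒length≤nCk n k L (L! , vertices) = subst (length L ≤_) (length-subsetsOfSize n k)
  (injectiveRelation⇒length≤ _≡_ L! (λ {T} T∈L → T , ∈-subsetsOfSize n k T (vertices T∈L) , refl)
    (λ _ _ T₁≢T₂ T₁≡ T₂≡ → T₁≢T₂ (trans T₁≡ (sym T₂≡))))

independent≤cliqueCover : ∀ {n k W 𝒞} → IsIndependent n k W → IsCliqueCover n k 𝒞 →
  length W ≤ length 𝒞
independent≤cliqueCover ((W! , W-vertices) , W-independent) (cliques , covers) =
  injectiveRelation⇒length≤ (λ S K → K ∈ _ × S ∈ K) W!
    (λ S∈W → let (K , K∈𝒞 , S∈K) = covers _ (W-vertices S∈W) in K , K∈𝒞 , K∈𝒞 , S∈K)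
    (λ S₁∈W S₂∈W S₁≢S₂ (K∈𝒞 , S₁∈K) (_ , S₂∈K) →
      W-independent S₁∈W S₂∈W S₁≢S₂ (proj₂ (cliques K∈𝒞) S₁∈K S₂∈K S₁≢S₂))

Unique-concatMap⁺ : ∀ {X Y : Set} (f : X → List Y) {xs : List X} → (∀ {x} → x ∈ xs → Unique (f x)) →
  (∀ {x₁ x₂} → x₁ ∈ xs → x₂ ∈ xs → x₁ ≢ x₂ → Disjoint (f x₁) (f x₂)) →
  Unique xs → Unique (concat (map f xs))
Unique-concatMap⁺ f uniques disjoint xs! =
  Unique.concat⁺ (All.map⁺ (All.tabulate uniques)) (AllPairs.map⁺ (AllPairs-map∈ disjoint xs!))

cliquesOfTotalSize-nCk⇒cover : ∀ n k (𝒞 : List (List (Subset n))) → (∀ {K} → K ∈ 𝒞 → IsClique n k K) →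
  Unique (concat 𝒞) → length (concat 𝒞) ≡ n C k → IsCliqueCover n k 𝒞
cliquesOfTotalSize-nCk⇒cover n k 𝒞 cliques ⋃𝒞! ∣⋃𝒞∣≡nCk = cliques , covers
  where
  member-vertex : ∀ {T} → T ∈ concat 𝒞 → IsVertex n k T
  member-vertex T∈⋃𝒞 = let (K , T∈K , K∈𝒞) = ∈-concat⁻′ 𝒞 T∈⋃𝒞 in proj₂ (proj₁ (cliques K∈𝒞)) T∈K

  covers : ∀ T → IsVertex n k T → ∃ λ K → K ∈ 𝒞 × T ∈ K
  covers T T-vertex with any? (λ T′ → Vec.≡-dec Bool._≟_ T T′) (concat 𝒞)
  ... | yes T∈⋃𝒞 = let (K , T∈K , K∈𝒞) = ∈-concat⁻′ 𝒞 T∈⋃𝒞 in K , K∈𝒞 , T∈K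
  ... | no  T∉⋃𝒞 = ⊥-elim (<-irrefl refl (subst (λ m → suc m ≤ n C k) ∣⋃𝒞∣≡nCk
        (vertexSet⇒length≤nCk n k (T ∷ concat 𝒞) (T∷⋃𝒞! , T∷⋃𝒞-vertices))))
    where
    T∷⋃𝒞! : Unique (T ∷ concat 𝒞)
    T∷⋃𝒞! = All.tabulate (λ T′∈ T≡T′ → T∉⋃𝒞 (subst (_∈ concat 𝒞) (sym T≡T′) T′∈)) ∷ ⋃𝒞!
    T∷⋃𝒞-vertices : ∀ {T′} → T′ ∈ T ∷ concat 𝒞 → IsVertex n k T′
    T∷⋃𝒞-vertices (here refl) = T-vertex
    T∷⋃𝒞-vertices (there T′∈) = member-vertex T′∈

cover≤independent⇒α≡θ : ∀ {n k W 𝒞 a t} → IsIndependent n k W → IsCliqueCover n k 𝒞 →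
  length 𝒞 ≤ length W → IsIndependenceNumber n k a → IsCliqueCoverNumber n k t → a ≡ t
cover≤independent⇒α≡θ W-independent 𝒞-cover ∣𝒞∣≤∣W∣
  ((W₁ , W₁-independent , refl) , a-maximum) ((𝒞₁ , 𝒞₁-cover , refl) , t-minimum) = ≤-antisym
  (independent≤cliqueCover W₁-independent 𝒞₁-cover)
  (≤-trans (t-minimum _ 𝒞-cover) (≤-trans ∣𝒞∣≤∣W∣ (a-maximum _ W-independent)))

length-concat-map : ∀ {X Y : Set} (f : X → List Y) (xs : List X) {w} →
  (∀ {x} → x ∈ xs → length (f x) ≡ w) → length (concat (map f xs)) ≡ length xs * w
length-concat-map f []       _     = refl
length-concat-map f (x ∷ xs) ∣f∣≡w =
  trans (length-++ (f x)) (cong₂ _+_ (∣f∣≡w (here refl)) (length-concat-map f xs (∣f∣≡w ∘ there)))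

proposition4p2 : (N k : ℕ) → 0 < k → k < N → (j : Fin N) →
    (W : List (Subset N)) → IsIndependent N k W →
    (∀ {S₁ S₂} → S₁ ∈ W → S₂ ∈ W → S₁ ≢ S₂ →
      ∀ {T} → T ∈ Cj N j S₁ → T ∈ Cj N j S₂ → ⊥)
    ×
    ((∀ W′ → IsIndependent N k W′ → length W′ ≤ length W) →
     (w : ℕ) → IsCliqueNumber N k w →
     length W * w ≡ N C k →
     (∀ {S} → S ∈ W → length (Cj N j S) ≡ w) →
       (IsCliqueCover N k (map (Cj N j) W) ×
        (∀ 𝒞 → IsCliqueCover N k 𝒞 → length (map (Cj N j) W) ≤ length 𝒞)) ×
       (∀ a t → IsIndependenceNumber N k a → IsCliqueCoverNumber N k t → a ≡ t))
proposition4p2 N k _ _ j W W-independent@((W! , vertex) , nonadjacent) =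
  disjoint , λ _ _ _ ∣W∣*w≡NCk ∣C∣≡w → let 𝒞-cover = cover ∣W∣*w≡NCk ∣C∣≡w in
    (𝒞-cover , minimal) ,
    λ _ _ → cover≤independent⇒α≡θ W-independent 𝒞-cover (≤-reflexive (length-map (Cj N j) W))
  where
  disjoint : ∀ {S₁ S₂} → S₁ ∈ W → S₂ ∈ W → S₁ ≢ S₂ → ∀ {T} → T ∈ Cj N j S₁ → T ∈ Cj N j S₂ → ⊥
  disjoint S₁∈W S₂∈W S₁≢S₂ T∈C₁ T∈C₂ =
    nonadjacent S₁∈W S₂∈W S₁≢S₂ (Cj-meet⇒Adj N k j (vertex S₁∈W) (vertex S₂∈W) S₁≢S₂ T∈C₁ T∈C₂)

  cliques : ∀ {K} → K ∈ map (Cj N j) W → IsClique N k K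
  cliques K∈ = let (S , S∈W , K≡) = ∈-map⁻ (Cj N j) K∈ in
    subst (IsClique N k) (sym K≡) (Cj-isClique N k j (vertex S∈W))

  cover : ∀ {w} → length W * w ≡ N C k → (∀ {S} → S ∈ W → length (Cj N j S) ≡ w) →
    IsCliqueCover N k (map (Cj N j) W)
  cover ∣W∣*w≡NCk ∣C∣≡w = cliquesOfTotalSize-nCk⇒cover N k (map (Cj N j) W) cliques
    (Unique-concatMap⁺ (Cj N j) (λ S∈W → proj₁ (proj₁ (Cj-isClique N k j (vertex S∈W))))
      (λ S₁∈W S₂∈W S₁≢S₂ (T∈C₁ , T∈C₂) → disjoint S₁∈W S₂∈W S₁≢S₂ T∈C₁ T∈C₂) W!)
    (trans (length-concat-map (Cj N j) W ∣C∣≡w) ∣W∣*w≡NCk)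

  minimal : ∀ 𝒞 → IsCliqueCover N k 𝒞 → length (map (Cj N j) W) ≤ length 𝒞
  minimal 𝒞 𝒞-cover =
    subst (_≤ length 𝒞) (sym (length-map (Cj N j) W)) (independent≤cliqueCover W-independent 𝒞-cover)
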